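{- Let $G$ be a connected graph (no loops, no multiple edges), $b\in V_G$, $\ell\in\mathbb{Z}_{\ge0}$, and $\mathbf{q}$ a $G$-path starting at $b$. The set $\operatorname{Tab}^{\mathbf{q},\infty}_{G,b,\ell}$ of extended $\mathbf{q}$-tableaux, ordered by $U\preceq^\infty U'$ iff $U(i)\ge U'(i)$ for all $i\in[1,\#\mathbf{q}]$, is a distributive lattice, with meet and join given by $(U\wedge U')(i)=\max\{U(i),U'(i)\}$ and $(U\vee U')(i)=\min\{U(i),U'(i)\}$.
   Context: A $G$-path $\mathbf{p}$ has length $\#\mathbf{p}$, edges $\mathbf{p}_i=\{p_{i-1},p_i\}\in E_G$ and vertices $p_0,\dots,p_{\#\mathbf{p}}$. A $(G,b,\ell)$-tableau is $(\mathbf{p},L)$ with $\mathbf{p}$ a $G$-path with $p_0=b$ and $L:[1,\#\mathbf{p}]\to\mathbb{Z}_{\ge0}$ satisfying (i) $L$ weakly increasing, (ii) $i<j$ and $p_{i-1}=p_j$ imply $L(i)<L(j)$, (iii) $L(\#\mathbf{p})+\#\mathbf{p}\le\ell$. An extended $\mathbf{q}$-tableau is a weakly increasing function $U:[1,\#\mathbf{q}]\to\mathbb{Z}_{\ge0}\cup\{\infty\}$ such that whenever $U(m)\in\mathbb{Z}_{\ge0}$, the pair $((\mathbf{q}_1,\dots,\mathbf{q}_m),U|_{[1,m]})$ (length-$m$ prefix of $\mathbf{q}$ with restricted labels) is a $(G,b,\ell)$-tableau. Here $\infty$ is larger than every integer. -}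

module Defs where

open import Level using (0ℓ)
open import Data.Nat as ℕ using (ℕ; zero; suc; _+_; _<_) renaming (_≤_ to _≤ℕ_)
open import Data.Fin as Fin using (Fin; zero; suc; toℕ; inject₁; inject≤; fromℕ)
open import Data.Fin.Properties using (toℕ-injective; toℕ-inject₁; toℕ-inject≤; toℕ<n)
open import Data.Product using (Σ; _×_; _,_)
open import Data.Unit using (⊤)
open import Data.Empty using (⊥)
open import Relation.Nullary using (¬_)
open import Relation.Binary.PropositionalEquality using (_≡_; refl; subst; trans; sym)

record Graph : Set₁ where
  field
    n         : ℕ
    Adj       : Fin n → Fin n → Set
    Adj-sym   : ∀ {u v} → Adj u v → Adj v u
    Adj-irrefl : ∀ {u} → ¬ Adj u u

  V : Set
  V = Fin n

open Graph public

-- Edge 𝐩_i (1 ≤ i ≤ len) is indexed by (i' : Fin len) with i = i'+1: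
-- p_{i-1} = vtx (inject₁ i'), p_i = vtx (suc i').

record GPath (G : Graph) : Set where
  field
    len : ℕ
    vtx : Fin (suc len) → V G
    adj : (i : Fin len) → Adj G (vtx (inject₁ i)) (vtx (suc i))

open GPath public

start : {G : Graph} → GPath G → V G
start p = vtx p zero

end : {G : Graph} → GPath G → V G
end p = vtx p (fromℕ (len p))

Connected : Graph → Set
Connected G = ∀ (u v : V G) → Σ (GPath G) λ p → (start p ≡ u) × (end p ≡ v)

private
  inj-lemma : ∀ {m k} (i : Fin m) (le : m ≤ℕ k) →
              inject≤ (inject₁ i) (ℕ.s≤s le) ≡ inject₁ (inject≤ i le)
  inj-lemma i le = toℕ-injective
    (trans (toℕ-inject≤ (inject₁ i) (ℕ.s≤s le))
      (trans (toℕ-inject₁ i)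
        (trans (sym (toℕ-inject≤ i le)) (sym (toℕ-inject₁ (inject≤ i le))))))

prefix : {G : Graph} (q : GPath G) (m : ℕ) → m ≤ℕ len q → GPath G
prefix {G} q m le = record
  { len = m
  ; vtx = λ i → vtx q (inject≤ i (ℕ.s≤s le))
  ; adj = λ i → subst (λ x → Adj G (vtx q x) (vtx q (suc (inject≤ i le))))
                      (sym (inj-lemma i le)) (adj q (inject≤ i le))
  }

-- (G,b,ℓ)-tableaux.  Position i ∈ [1,#𝐩] is represented by i' : Fin #𝐩
-- with i = i'+1.

LastBound : (k : ℕ) → (Fin k → ℕ) → ℕ → Set
LastBound zero    L ℓ = ⊤
LastBound (suc k) L ℓ = L (fromℕ k) + suc k ≤ℕ ℓ

record IsTableau (G : Graph) (b : V G) (ℓ : ℕ) (p : GPath G) (L : Fin (len p) → ℕ) : Set where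
  field
    starts-at-b : start p ≡ b
    mono        : ∀ (i j : Fin (len p)) → i Fin.≤ j → L i ≤ℕ L j
    revisit     : ∀ (i j : Fin (len p)) → i Fin.< j →
                  vtx p (inject₁ i) ≡ vtx p (suc j) → L i < L j
    bound       : LastBound (len p) L ℓ

data ℕ∞ : Set where
  fin : ℕ → ℕ∞
  ∞   : ℕ∞

data _≤∞_ : ℕ∞ → ℕ∞ → Set where
  fin≤fin : ∀ {a b} → a ≤ℕ b → fin a ≤∞ fin b
  _≤∞∞    : ∀ x → x ≤∞ ∞

max∞ : ℕ∞ → ℕ∞ → ℕ∞
max∞ (fin a) (fin b) = fin (a ℕ.⊔ b)
max∞ (fin a) ∞       = ∞
max∞ ∞       y       = ∞

min∞ : ℕ∞ → ℕ∞ → ℕ∞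
min∞ (fin a) (fin b) = fin (a ℕ.⊓ b)
min∞ (fin a) ∞       = fin a
min∞ ∞       y       = y

record IsExtTableau (G : Graph) (b : V G) (ℓ : ℕ) (q : GPath G) (U : Fin (len q) → ℕ∞) : Set where
  field
    mono   : ∀ (i j : Fin (len q)) → i Fin.≤ j → U i ≤∞ U j
    -- if U(m) ∈ ℤ≥0 (m = i'+1) then ((𝐪_1,…,𝐪_m), U|[1,m]) is a (G,b,ℓ)-tableau
    prefix-tab : ∀ (i : Fin (len q)) (k : ℕ) → U i ≡ fin k →
      Σ (Fin (suc (toℕ i)) → ℕ) λ L →
        (∀ j → U (inject≤ j (toℕ<n i)) ≡ fin (L j)) ×
        IsTableau G b ℓ (prefix q (suc (toℕ i)) (toℕ<n i)) L

Tab∞ : (G : Graph) (b : V G) (ℓ : ℕ) (q : GPath G) → Set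
Tab∞ G b ℓ q = Σ (Fin (len q) → ℕ∞) (IsExtTableau G b ℓ q)

module _ {G : Graph} {b : V G} {ℓ : ℕ} {q : GPath G} where

  _≈T_ : Tab∞ G b ℓ q → Tab∞ G b ℓ q → Set
  (U , _) ≈T (U' , _) = ∀ i → U i ≡ U' i

  _⪯∞_ : Tab∞ G b ℓ q → Tab∞ G b ℓ q → Set
  (U , _) ⪯∞ (U' , _) = ∀ i → U' i ≤∞ U i

  MaxClosed : Set
  MaxClosed = ∀ (U U' : Fin (len q) → ℕ∞) → IsExtTableau G b ℓ q U → IsExtTableau G b ℓ q U' →
              IsExtTableau G b ℓ q (λ i → max∞ (U i) (U' i))

  MinClosed : Set
  MinClosed = ∀ (U U' : Fin (len q) → ℕ∞) → IsExtTableau G b ℓ q U → IsExtTableau G b ℓ q U' →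
              IsExtTableau G b ℓ q (λ i → min∞ (U i) (U' i))

  meetT : MaxClosed → Tab∞ G b ℓ q → Tab∞ G b ℓ q → Tab∞ G b ℓ q
  meetT c (U , u) (U' , u') = (λ i → max∞ (U i) (U' i)) , c U U' u u'

  joinT : MinClosed → Tab∞ G b ℓ q → Tab∞ G b ℓ q → Tab∞ G b ℓ q
  joinT c (U , u) (U' , u') = (λ i → min∞ (U i) (U' i)) , c U U' u u'

{-# OPTIONS --safe #-}
-- An extended tableau is characterised by local conditions: U is monotone, U(i) is
-- strictly below U(j) whenever i < j, p_{i-1} = p_j and U(j) is finite, and every
-- finite label satisfies U(i) + i ≤ ℓ; the prefix condition adds nothing beyond
-- these. Pointwise max and min are monotone, commute with x ↦ x + 1 on ℕ ∪ {∞}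
-- and select one of their arguments, so they preserve all three conditions; the
-- lattice laws are then inherited pointwise from ℕ ∪ {∞} ordered by ≥.
module Submission where

open import Defs
open import Data.Nat using (ℕ)
open import Data.Product using (Σ; _,_)
open import Relation.Binary.PropositionalEquality using (_≡_)
open import Relation.Binary.Lattice.Structures using (IsDistributiveLattice)

open import Level using (0ℓ)
open import Algebra.Core using (Op₂)
open import Algebra.Definitions using (Selective)
open import Data.Nat using (suc; _+_; _≤_; _<_; s≤s; s≤s⁻¹)
import Data.Nat.Properties as ℕ
open import Data.Fin as Fin using (Fin; suc; toℕ; inject₁; inject≤; fromℕ; fromℕ<)
open import Data.Fin.Properties
  using (toℕ-injective; toℕ-inject₁; toℕ-inject≤; toℕ<n; toℕ-fromℕ; toℕ-fromℕ<)
open import Data.Product using (∃; _×_; proj₁; proj₂)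
open import Data.Sum using (inj₁; inj₂)
open import Data.Unit using (⊤)
open import Function using (flip)
open import Relation.Binary.Core using (Rel; _Preserves₂_⟶_⟶_)
open import Relation.Binary.PropositionalEquality
  using (refl; sym; trans; cong; subst; subst₂; isEquivalence)

≤∞-refl : ∀ {x} → x ≤∞ x
≤∞-refl {fin a} = fin≤fin ℕ.≤-refl
≤∞-refl {∞}     = ∞ ≤∞∞

≤∞-trans : ∀ {x y z} → x ≤∞ y → y ≤∞ z → x ≤∞ z
≤∞-trans (fin≤fin p) (fin≤fin q) = fin≤fin (ℕ.≤-trans p q)
≤∞-trans {x} _       (_ ≤∞∞)     = x ≤∞∞

≤∞-antisym : ∀ {x y} → x ≤∞ y → y ≤∞ x → x ≡ y
≤∞-antisym (fin≤fin p) (fin≤fin q) = cong fin (ℕ.≤-antisym p q)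
≤∞-antisym (_ ≤∞∞)     (_ ≤∞∞)     = refl

fin≤fin⁻¹ : ∀ {a b} → fin a ≤∞ fin b → a ≤ b
fin≤fin⁻¹ (fin≤fin a≤b) = a≤b

≤fin⇒finite : ∀ {x k} → x ≤∞ fin k → ∃ λ a → x ≡ fin a
≤fin⇒finite (fin≤fin {a} _) = a , refl

min∞≤ˡ : ∀ x y → min∞ x y ≤∞ x
min∞≤ˡ (fin a) (fin b) = fin≤fin (ℕ.m⊓n≤m a b)
min∞≤ˡ (fin a) ∞       = ≤∞-refl
min∞≤ˡ ∞       y       = y ≤∞∞

min∞≤ʳ : ∀ x y → min∞ x y ≤∞ y
min∞≤ʳ (fin a) (fin b) = fin≤fin (ℕ.m⊓n≤n a b)
min∞≤ʳ (fin a) ∞       = fin a ≤∞∞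
min∞≤ʳ ∞       y       = ≤∞-refl

min∞-glb : ∀ {x y z} → z ≤∞ x → z ≤∞ y → z ≤∞ min∞ x y
min∞-glb (fin≤fin p) (fin≤fin q) = fin≤fin (ℕ.⊓-glb p q)
min∞-glb (fin≤fin p) (_ ≤∞∞)     = fin≤fin p
min∞-glb (_ ≤∞∞)     q           = q

≤max∞ˡ : ∀ x y → x ≤∞ max∞ x y
≤max∞ˡ (fin a) (fin b) = fin≤fin (ℕ.m≤m⊔n a b)
≤max∞ˡ (fin a) ∞       = fin a ≤∞∞
≤max∞ˡ ∞       y       = ≤∞-refl

≤max∞ʳ : ∀ x y → y ≤∞ max∞ x y
≤max∞ʳ (fin a) (fin b) = fin≤fin (ℕ.m≤n⊔m a b)
≤max∞ʳ (fin a) ∞       = ≤∞-refl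
≤max∞ʳ ∞       y       = y ≤∞∞

max∞-lub : ∀ {x y z} → x ≤∞ z → y ≤∞ z → max∞ x y ≤∞ z
max∞-lub (fin≤fin p) (fin≤fin q) = fin≤fin (ℕ.⊔-lub p q)
max∞-lub {x} {y}     _ (_ ≤∞∞)   = max∞ x y ≤∞∞

max∞-mono-≤ : max∞ Preserves₂ _≤∞_ ⟶ _≤∞_ ⟶ _≤∞_
max∞-mono-≤ {y = y} {v = v} p q =
  max∞-lub (≤∞-trans p (≤max∞ˡ y v)) (≤∞-trans q (≤max∞ʳ y v))

min∞-mono-≤ : min∞ Preserves₂ _≤∞_ ⟶ _≤∞_ ⟶ _≤∞_
min∞-mono-≤ {x = x} {u = u} p q =
  min∞-glb (≤∞-trans (min∞≤ˡ x u) p) (≤∞-trans (min∞≤ʳ x u) q)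

max∞-sel : Selective _≡_ max∞
max∞-sel (fin a) (fin b) with ℕ.⊔-sel a b
... | inj₁ e = inj₁ (cong fin e)
... | inj₂ e = inj₂ (cong fin e)
max∞-sel (fin a) ∞       = inj₂ refl
max∞-sel ∞       y       = inj₁ refl

min∞-sel : Selective _≡_ min∞
min∞-sel (fin a) (fin b) with ℕ.⊓-sel a b
... | inj₁ e = inj₁ (cong fin e)
... | inj₂ e = inj₂ (cong fin e)
min∞-sel (fin a) ∞       = inj₁ refl
min∞-sel ∞       y       = inj₂ refl

max∞-distribˡ-min∞ : ∀ x y z → max∞ x (min∞ y z) ≡ min∞ (max∞ x y) (max∞ x z)
max∞-distribˡ-min∞ ∞       y       z       = refl
max∞-distribˡ-min∞ (fin a) ∞       z       = refl
max∞-distribˡ-min∞ (fin a) (fin b) ∞       = refl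
max∞-distribˡ-min∞ (fin a) (fin b) (fin c) = cong fin (ℕ.⊔-distribˡ-⊓ a b c)

≥∞-isDistributiveLattice : IsDistributiveLattice _≡_ (flip _≤∞_) min∞ max∞
≥∞-isDistributiveLattice = record
  { isLattice = record
    { isPartialOrder = record
      { isPreorder = record
        { isEquivalence = isEquivalence
        ; reflexive     = λ { refl → ≤∞-refl }
        ; trans         = flip ≤∞-trans
        }
      ; antisym = flip ≤∞-antisym
      }
    ; supremum = λ x y → min∞≤ˡ x y , min∞≤ʳ x y , λ _ → min∞-glb
    ; infimum  = λ x y → ≤max∞ˡ x y , ≤max∞ʳ x y , λ _ → max∞-lub
    }
  ; ∧-distribˡ-∨ = max∞-distribˡ-min∞
  }

suc∞ : ℕ∞ → ℕ∞
suc∞ (fin a) = fin (suc a)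
suc∞ ∞       = ∞

-- Strict order, except that ∞ ⊏ ∞: this is how condition (ii) exempts ∞.
_⊏_ : ℕ∞ → ℕ∞ → Set
x ⊏ y = suc∞ x ≤∞ y

suc∞-distrib-max∞ : ∀ x y → suc∞ (max∞ x y) ≡ max∞ (suc∞ x) (suc∞ y)
suc∞-distrib-max∞ (fin a) (fin b) = refl
suc∞-distrib-max∞ (fin a) ∞       = refl
suc∞-distrib-max∞ ∞       y       = refl

suc∞-distrib-min∞ : ∀ x y → suc∞ (min∞ x y) ≡ min∞ (suc∞ x) (suc∞ y)
suc∞-distrib-min∞ (fin a) (fin b) = refl
suc∞-distrib-min∞ (fin a) ∞       = refl
suc∞-distrib-min∞ ∞       y       = refl

max∞-mono-⊏ : max∞ Preserves₂ _⊏_ ⟶ _⊏_ ⟶ _⊏_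
max∞-mono-⊏ {x = x} {u = u} p q =
  subst (_≤∞ _) (sym (suc∞-distrib-max∞ x u)) (max∞-mono-≤ p q)

min∞-mono-⊏ : min∞ Preserves₂ _⊏_ ⟶ _⊏_ ⟶ _⊏_
min∞-mono-⊏ {x = x} {u = u} p q =
  subst (_≤∞ _) (sym (suc∞-distrib-min∞ x u)) (min∞-mono-≤ p q)

selective-preserves : ∀ {A : Set} {_∙_ : Op₂ A} → Selective _≡_ _∙_ →
                      (P : A → Set) → ∀ {x y} → P x → P y → P (x ∙ y)
selective-preserves sel P {x} {y} px py with sel x y
... | inj₁ e = subst P (sym e) px
... | inj₂ e = subst P (sym e) py

Closed₂ : {I A : Set} → ((I → A) → Set) → Op₂ A → Set
Closed₂ P _∙_ = ∀ U V → P U → P V → P (λ i → U i ∙ V i)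

lift₂ : {I A : Set} {P : (I → A) → Set} (_∙_ : Op₂ A) →
        Closed₂ P _∙_ → Op₂ (Σ (I → A) P)
lift₂ _∙_ closed (U , u) (V , v) = (λ i → U i ∙ V i) , closed U V u v

module _ {A : Set} {_≤ᴬ_ : Rel A 0ℓ} {_∨_ _∧_ : Op₂ A}
         (L : IsDistributiveLattice _≡_ _≤ᴬ_ _∨_ _∧_)
         {I : Set} (P : (I → A) → Set) where

  open IsDistributiveLattice L
    using (reflexive; antisym; x≤x∨y; y≤x∨y; ∨-least; x∧y≤x; x∧y≤y; ∧-greatest; ∧-distribˡ-∨)
    renaming (trans to ≤-trans)

  closed-isDistributiveLattice :
    (∨-closed : Closed₂ P _∨_) (∧-closed : Closed₂ P _∧_) →
    IsDistributiveLattice (λ x y → ∀ i → proj₁ x i ≡ proj₁ y i)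
                          (λ x y → ∀ i → proj₁ x i ≤ᴬ proj₁ y i)
                          (lift₂ _∨_ ∨-closed) (lift₂ _∧_ ∧-closed)
  closed-isDistributiveLattice _ _ = record
    { isLattice = record
      { isPartialOrder = record
        { isPreorder = record
          { isEquivalence = record
            { refl  = λ i → refl
            ; sym   = λ p i → sym (p i)
            ; trans = λ p q i → trans (p i) (q i)
            }
          ; reflexive = λ p i → reflexive (p i)
          ; trans     = λ p q i → ≤-trans (p i) (q i)
          }
        ; antisym = λ p q i → antisym (p i) (q i)
        }
      ; supremum = λ (U , _) (V , _) →
          (λ i → x≤x∨y (U i) (V i)) , (λ i → y≤x∨y (U i) (V i)) ,
          λ _ p q i → ∨-least (p i) (q i)
      ; infimum = λ (U , _) (V , _) →
          (λ i → x∧y≤x (U i) (V i)) , (λ i → x∧y≤y (U i) (V i)) ,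
          λ _ p q i → ∧-greatest (p i) (q i)
      }
    ; ∧-distribˡ-∨ = λ (U , _) (V , _) (W , _) i → ∧-distribˡ-∨ (U i) (V i) (W i)
    }

toℕ-≡⇒inject≤-≡ : ∀ {m n} {i : Fin m} {j : Fin n} .(m≤n : m ≤ n) →
                  toℕ i ≡ toℕ j → inject≤ i m≤n ≡ j
toℕ-≡⇒inject≤-≡ {i = i} m≤n eq = toℕ-injective (trans (toℕ-inject≤ i m≤n) eq)

inject≤-inject₁ : ∀ {m n} (i : Fin m) .(m≤n : m ≤ n) →
                  inject≤ (inject₁ i) (s≤s m≤n) ≡ inject₁ (inject≤ i m≤n)
inject≤-inject₁ i m≤n = toℕ-≡⇒inject≤-≡ (s≤s m≤n)
  (trans (toℕ-inject₁ i) (sym (trans (toℕ-inject₁ _) (toℕ-inject≤ i m≤n))))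

Bounded : ℕ → ℕ → ℕ∞ → Set
Bounded ℓ n (fin k) = k + n ≤ ℓ
Bounded ℓ n ∞       = ⊤

module _ (G : Graph) (b : V G) (ℓ : ℕ) (q : GPath G) where

  fromPrefix : (c : Fin (len q)) → Fin (suc (toℕ c)) → Fin (len q)
  fromPrefix c j = inject≤ j (toℕ<n c)

  toPrefix : (c a : Fin (len q)) → a Fin.≤ c → Fin (suc (toℕ c))
  toPrefix c a a≤c = fromℕ< (s≤s a≤c)

  fromPrefix-toPrefix : ∀ c a (a≤c : a Fin.≤ c) → fromPrefix c (toPrefix c a a≤c) ≡ a
  fromPrefix-toPrefix c a a≤c = toℕ-≡⇒inject≤-≡ (toℕ<n c) (toℕ-fromℕ< (s≤s a≤c))

  fromPrefix-last : ∀ c → fromPrefix c (fromℕ (toℕ c)) ≡ c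
  fromPrefix-last c = toℕ-≡⇒inject≤-≡ (toℕ<n c) (toℕ-fromℕ (toℕ c))

  fromPrefix-≤ : ∀ c j → fromPrefix c j Fin.≤ c
  fromPrefix-≤ c j = subst (_≤ toℕ c) (sym (toℕ-inject≤ j (toℕ<n c))) (s≤s⁻¹ (toℕ<n j))

  fromPrefix-mono-≤ : ∀ c {i j} → i Fin.≤ j → fromPrefix c i Fin.≤ fromPrefix c j
  fromPrefix-mono-≤ c {i} {j} =
    subst₂ _≤_ (sym (toℕ-inject≤ i (toℕ<n c))) (sym (toℕ-inject≤ j (toℕ<n c)))

  fromPrefix-mono-< : ∀ c {i j} → i Fin.< j → fromPrefix c i Fin.< fromPrefix c j
  fromPrefix-mono-< c {i} {j} =
    subst₂ _<_ (sym (toℕ-inject≤ i (toℕ<n c))) (sym (toℕ-inject≤ j (toℕ<n c)))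

  Prefix : Fin (len q) → GPath G
  Prefix c = prefix q (suc (toℕ c)) (toℕ<n c)

  prefix-vtx-inject₁ : ∀ c j → vtx (Prefix c) (inject₁ j) ≡ vtx q (inject₁ (fromPrefix c j))
  prefix-vtx-inject₁ c j = cong (vtx q) (inject≤-inject₁ j (toℕ<n c))

  Revisit : Fin (len q) → Fin (len q) → Set
  Revisit i j = vtx q (inject₁ i) ≡ vtx q (suc j)

  record IsLocalTableau (U : Fin (len q) → ℕ∞) : Set where
    field
      mono    : ∀ i j → i Fin.≤ j → U i ≤∞ U j
      revisit : ∀ i j → i Fin.< j → Revisit i j → U i ⊏ U j
      bound   : ∀ i → Bounded ℓ (suc (toℕ i)) (U i)

  module _ {U : Fin (len q) → ℕ∞} (ext : IsExtTableau G b ℓ q U) where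
    open IsExtTableau ext

    revisit-at : ∀ a c → a Fin.< c → Revisit a c → U a ⊏ U c
    revisit-at a c a<c same with U c in Uc≡
    ... | ∞     = _ ≤∞∞
    ... | fin k with prefix-tab c k Uc≡
    ... | L , U≡L , tab = subst₂ _⊏_ Ua≡ Uc≡′ (fin≤fin (IsTableau.revisit tab a′ c′ a′<c′ same′))
      where
      a≤c : a Fin.≤ c
      a≤c = ℕ.<⇒≤ a<c
      a′ c′ : Fin (suc (toℕ c))
      a′ = toPrefix c a a≤c
      c′ = fromℕ (toℕ c)
      a′↦a : fromPrefix c a′ ≡ a
      a′↦a = fromPrefix-toPrefix c a a≤c
      c′↦c : fromPrefix c c′ ≡ c
      c′↦c = fromPrefix-last c
      Ua≡ : fin (L a′) ≡ U a
      Ua≡ = trans (sym (U≡L a′)) (cong U a′↦a)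
      Uc≡′ : fin (L c′) ≡ fin k
      Uc≡′ = trans (sym (U≡L c′)) (trans (cong U c′↦c) Uc≡)
      a′<c′ : a′ Fin.< c′
      a′<c′ = subst₂ _<_ (sym (toℕ-fromℕ< (s≤s a≤c))) (sym (toℕ-fromℕ (toℕ c))) a<c
      same′ : vtx (Prefix c) (inject₁ a′) ≡ vtx (Prefix c) (suc c′)
      same′ = trans (prefix-vtx-inject₁ c a′) (subst₂ Revisit (sym a′↦a) (sym c′↦c) same)

    bound-at : ∀ c → Bounded ℓ (suc (toℕ c)) (U c)
    bound-at c with U c in Uc≡
    ... | ∞     = _
    ... | fin k with prefix-tab c k Uc≡
    ... | L , U≡L , tab = subst (Bounded ℓ (suc (toℕ c))) Uc≡′ (IsTableau.bound tab)
      where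
      Uc≡′ : fin (L (fromℕ (toℕ c))) ≡ fin k
      Uc≡′ = trans (sym (U≡L (fromℕ (toℕ c)))) (trans (cong U (fromPrefix-last c)) Uc≡)

    extTableau⇒local : IsLocalTableau U
    extTableau⇒local = record { mono = mono ; revisit = revisit-at ; bound = bound-at }

  module _ {U : Fin (len q) → ℕ∞} (start≡b : start q ≡ b) (loc : IsLocalTableau U) where
    open IsLocalTableau loc

    prefix-tableau : ∀ c k → U c ≡ fin k →
      Σ (Fin (suc (toℕ c)) → ℕ) λ L →
        (∀ j → U (fromPrefix c j) ≡ fin (L j)) ×
        IsTableau G b ℓ (Prefix c) L
    prefix-tableau c k Uc≡ = L , U≡L , tableau
      where
      finite : ∀ j → ∃ λ a → U (fromPrefix c j) ≡ fin a
      finite j = ≤fin⇒finite (subst (U (fromPrefix c j) ≤∞_) Uc≡ (mono _ c (fromPrefix-≤ c j)))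
      L : Fin (suc (toℕ c)) → ℕ
      L j = proj₁ (finite j)
      U≡L : ∀ j → U (fromPrefix c j) ≡ fin (L j)
      U≡L j = proj₂ (finite j)
      tableau : IsTableau G b ℓ (Prefix c) L
      tableau = record
        { starts-at-b = start≡b
        ; mono = λ i j i≤j → fin≤fin⁻¹
            (subst₂ _≤∞_ (U≡L i) (U≡L j) (mono _ _ (fromPrefix-mono-≤ c i≤j)))
        ; revisit = λ i j i<j same → fin≤fin⁻¹
            (subst₂ _⊏_ (U≡L i) (U≡L j) (revisit _ _ (fromPrefix-mono-< c i<j)
              (trans (sym (prefix-vtx-inject₁ c i)) same)))
        ; bound = subst (Bounded ℓ (suc (toℕ c)))
            (trans (cong U (sym (fromPrefix-last c))) (U≡L (fromℕ (toℕ c)))) (bound c)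
        }

    local⇒extTableau : IsExtTableau G b ℓ q U
    local⇒extTableau = record { mono = mono ; prefix-tab = prefix-tableau }

  local-closed : ∀ {_∙_} → Selective _≡_ _∙_ →
                 _∙_ Preserves₂ _≤∞_ ⟶ _≤∞_ ⟶ _≤∞_ → _∙_ Preserves₂ _⊏_ ⟶ _⊏_ ⟶ _⊏_ →
                 Closed₂ IsLocalTableau _∙_
  local-closed sel mono-≤ mono-⊏ U V u v = record
    { mono    = λ i j i≤j → mono-≤ (mono u i j i≤j) (mono v i j i≤j)
    ; revisit = λ i j i<j same → mono-⊏ (revisit u i j i<j same) (revisit v i j i<j same)
    ; bound   = λ i → selective-preserves sel (Bounded ℓ (suc (toℕ i))) (bound u i) (bound v i)
    }
    where open IsLocalTableau

  extTableau-closed : ∀ {_∙_} → start q ≡ b → Selective _≡_ _∙_ →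
                      _∙_ Preserves₂ _≤∞_ ⟶ _≤∞_ ⟶ _≤∞_ → _∙_ Preserves₂ _⊏_ ⟶ _⊏_ ⟶ _⊏_ →
                      Closed₂ (IsExtTableau G b ℓ q) _∙_
  extTableau-closed start≡b sel mono-≤ mono-⊏ U V u v = local⇒extTableau start≡b
    (local-closed sel mono-≤ mono-⊏ U V (extTableau⇒local u) (extTableau⇒local v))

lemma3p6 : (G : Graph) → Connected G → (b : V G) (ℓ : ℕ) (q : GPath G) → start q ≡ b →
    Σ (MaxClosed {G} {b} {ℓ} {q}) λ cmax →
    Σ (MinClosed {G} {b} {ℓ} {q}) λ cmin →
    IsDistributiveLattice (_≈T_ {G} {b} {ℓ} {q}) (_⪯∞_ {G} {b} {ℓ} {q}) (joinT cmin) (meetT cmax)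
lemma3p6 G _ b ℓ q start≡b =
  max-closed , min-closed ,
  closed-isDistributiveLattice ≥∞-isDistributiveLattice (IsExtTableau G b ℓ q) min-closed max-closed
  where
  max-closed : MaxClosed {G} {b} {ℓ} {q}
  max-closed = extTableau-closed G b ℓ q start≡b max∞-sel max∞-mono-≤ max∞-mono-⊏
  min-closed : MinClosed {G} {b} {ℓ} {q}
  min-closed = extTableau-closed G b ℓ q start≡b min∞-sel min∞-mono-≤ min∞-mono-⊏
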